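{- Let $C$ be a set, $G$ a Plott function on $C$, $Y\subseteq C$, and $(X_i)_{i\in I}$ a family of subsets of $C$ such that $X_i\preceq_G Y$ for every $i\in I$. Then $\bigcup_{i\in I}X_i\preceq_G Y$.
   Context: A choice function on a set $C$ is a map $G:2^C\to 2^C$ with $G(X)\subseteq X$ for all $X\subseteq C$. It is a Plott function if $G(X\cup Y)=G(G(X)\cup Y)$ for all $X,Y\subseteq C$. The Blair hyper-relation $\preceq_G$ on subsets of $C$ is defined by: $A\preceq_G B$ iff $G(A\cup B)\subseteq B$. -}

module Defs where

open import Level using (Level; _⊔_)
open import Data.Bool using (Bool; true; false; _∨_)
open import Data.Product using (_×_; ∃-syntax)
open import Relation.Binary.PropositionalEquality using (_≡_)

-- A subset of C is an element of 2^C, i.e. a map C → Bool (its indicator).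
Subset : ∀ {c} → Set c → Set c
Subset C = C → Bool

module _ {c : Level} {C : Set c} where

  _∈_ : C → Subset C → Set
  x ∈ A = A x ≡ true

  _≐_ : Subset C → Subset C → Set c
  A ≐ B = ∀ x → A x ≡ B x

  _⊆_ : Subset C → Subset C → Set c
  A ⊆ B = ∀ x → x ∈ A → x ∈ B

  _∪_ : Subset C → Subset C → Subset C
  (A ∪ B) x = A x ∨ B x

  IsUnionOf : ∀ {ι} {I : Set ι} → (I → Subset C) → Subset C → Set (c ⊔ ι)
  IsUnionOf {I = I} X U = ∀ x → (x ∈ U → ∃[ i ] x ∈ X i) × (∃[ i ] x ∈ X i → x ∈ U)

  -- a map 2^C → 2^C (well defined on subsets, i.e. respecting ≐)
  IsMap : (Subset C → Subset C) → Set c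
  IsMap G = ∀ A B → A ≐ B → G A ≐ G B

  IsChoiceFunction : (Subset C → Subset C) → Set c
  IsChoiceFunction G = IsMap G × (∀ X → G X ⊆ X)

  IsPlott : (Subset C → Subset C) → Set c
  IsPlott G = IsChoiceFunction G × (∀ X Y → G (X ∪ Y) ≐ G (G X ∪ Y))

  _≼[_]_ : Subset C → (Subset C → Subset C) → Subset C → Set c
  A ≼[ G ] B = G (A ∪ B) ⊆ B

-- A Plott function has the heritage (Chernoff) property: if T ⊆ S then G(S) ∩ T ⊆ G(T).
-- Indeed S = T ∪ (S ∖ T), so G(S) = G(G(T) ∪ (S ∖ T)) ⊆ G(T) ∪ (S ∖ T), and a point of T
-- is not in S ∖ T. Now let x ∈ G(U ∪ Y). Either x ∈ Y, or x ∈ X i for some i; then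
-- heritage applied to X i ∪ Y ⊆ U ∪ Y gives x ∈ G(X i ∪ Y) ⊆ Y.
module Submission where

open import Level using (Level)
open import Data.Bool using (true; false; _∧_; not)
open import Data.Empty using (⊥)
open import Data.Product using (_,_; proj₁; proj₂)
open import Data.Sum using (_⊎_; inj₁; inj₂)
open import Relation.Binary.PropositionalEquality using (refl; sym; trans)
open import Defs

module _ {c : Level} {C : Set c} where

  _∖_ : Subset C → Subset C → Subset C
  (A ∖ B) x = A x ∧ not (B x)

  ⊆-∪ˡ : ∀ (A B : Subset C) → A ⊆ (A ∪ B)
  ⊆-∪ˡ A B x x∈A rewrite x∈A = refl

  ⊆-∪ʳ : ∀ (A B : Subset C) → B ⊆ (A ∪ B)
  ⊆-∪ʳ A B x x∈B with A x
  ... | true  = refl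
  ... | false = x∈B

  ∈-∪⁻ : ∀ (A B : Subset C) x → x ∈ (A ∪ B) → x ∈ A ⊎ x ∈ B
  ∈-∪⁻ A B x x∈A∪B with A x
  ... | true  = inj₁ refl
  ... | false = inj₂ x∈A∪B

  ∪-monoˡ-⊆ : ∀ (A A′ B : Subset C) → A ⊆ A′ → (A ∪ B) ⊆ (A′ ∪ B)
  ∪-monoˡ-⊆ A A′ B A⊆A′ x x∈A∪B with ∈-∪⁻ A B x x∈A∪B
  ... | inj₁ x∈A = ⊆-∪ˡ A′ B x (A⊆A′ x x∈A)
  ... | inj₂ x∈B = ⊆-∪ʳ A′ B x x∈B

  ∉-∖ : ∀ (A B : Subset C) x → x ∈ B → x ∈ (A ∖ B) → ⊥
  ∉-∖ A B x x∈B x∈A∖B rewrite x∈B with A x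
  ... | true  with () ← x∈A∖B
  ... | false with () ← x∈A∖B

  ∪-∖-≐ : ∀ (A B : Subset C) → B ⊆ A → (B ∪ (A ∖ B)) ≐ A
  ∪-∖-≐ A B B⊆A x with B x in x∈B
  ... | true  = sym (B⊆A x x∈B)
  ... | false with A x
  ...   | true  = refl
  ...   | false = refl

  module _ {G : Subset C → Subset C} (plott : IsPlott G) where

    private
      G-map : IsMap G
      G-map = proj₁ (proj₁ plott)

      G-⊆ : ∀ A → G A ⊆ A
      G-⊆ = proj₂ (proj₁ plott)

      G-path : ∀ A B → G (A ∪ B) ≐ G (G A ∪ B)
      G-path = proj₂ plott

    G-∪-⊆ : ∀ (A B : Subset C) → G (A ∪ B) ⊆ (G A ∪ B)
    G-∪-⊆ A B x x∈G = G-⊆ (G A ∪ B) x (trans (sym (G-path A B x)) x∈G)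

    heritage : ∀ (S T : Subset C) → T ⊆ S → ∀ x → x ∈ G S → x ∈ T → x ∈ G T
    heritage S T T⊆S x x∈GS x∈T with ∈-∪⁻ (G T) (S ∖ T) x x∈G[T∪S∖T]
      where
      x∈G[T∪S∖T] : x ∈ (G T ∪ (S ∖ T))
      x∈G[T∪S∖T] = G-∪-⊆ T (S ∖ T) x
        (trans (G-map (T ∪ (S ∖ T)) S (∪-∖-≐ S T T⊆S) x) x∈GS)
    ... | inj₁ x∈GT  = x∈GT
    ... | inj₂ x∈S∖T with () ← ∉-∖ S T x x∈T x∈S∖T

lemma2 : ∀ {c ι : Level} (C : Set c) (G : Subset C → Subset C) → IsPlott G →
           (Y : Subset C) (I : Set ι) (X : I → Subset C) →
           (∀ i → X i ≼[ G ] Y) →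
           (U : Subset C) → IsUnionOf X U →
           U ≼[ G ] Y
lemma2 C G plott Y I X X≼Y U U=⋃X x x∈G[U∪Y]
  with ∈-∪⁻ U Y x (proj₂ (proj₁ plott) (U ∪ Y) x x∈G[U∪Y])
... | inj₂ x∈Y = x∈Y
... | inj₁ x∈U with proj₁ (U=⋃X x) x∈U
...   | i , x∈Xi =
  X≼Y i x (heritage plott (U ∪ Y) (X i ∪ Y) Xi∪Y⊆U∪Y x x∈G[U∪Y] (⊆-∪ˡ (X i) Y x x∈Xi))
  where
  Xi∪Y⊆U∪Y : (X i ∪ Y) ⊆ (U ∪ Y)
  Xi∪Y⊆U∪Y = ∪-monoˡ-⊆ (X i) U Y (λ z z∈Xi → proj₂ (U=⋃X z) (i , z∈Xi))
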